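{- Let $\mathbb{F}_q$ be a finite field, let $s,d,r\in\mathbb{N}$ with $1\le s\le d-2$ and $d-s+1\le r\le d$, let $\boldsymbol{a}=(a_{d-1},\ldots,a_{d-s})\in\mathbb{F}_q^s$ and $f_{\boldsymbol{a}}:=T^d+a_{d-1}T^{d-1}+\cdots+a_{d-s}T^{d-s}$. Let $X_1,\ldots,X_r$ be indeterminates, $Q:=(T-X_1)\cdots(T-X_r)\in\mathbb{F}_q[X_1,\ldots,X_r][T]$, and let $R_{\boldsymbol{a}}=R_{r-1}^{\boldsymbol{a}}T^{r-1}+\cdots+R_0^{\boldsymbol{a}}\in\mathbb{F}_q[X_1,\ldots,X_r][T]$ be the unique polynomial of degree at most $r-1$ in $T$ with $f_{\boldsymbol{a}}\equiv R_{\boldsymbol{a}}\pmod Q$. Let $\mathcal{X}_r=\{x_1,\ldots,x_r\}\subseteq\mathbb{F}_q$ be a set with $r$ elements and let $$\mathcal{S}_{\mathcal{X}_r}^{\boldsymbol{a}}:=\{g\in\mathbb{F}_q[T]:\deg g\le d-s-1,\ (f_{\boldsymbol{a}}+g)(x)=0\text{ for all }x\in\mathcal{X}_r\}.$$ Then $\mathcal{S}_{\mathcal{X}_r}^{\boldsymbol{a}}$ is nonempty if and only if $R_j^{\boldsymbol{a}}(x_1,\ldots,x_r)=0$ for all $j$ with $d-s\le j\le r-1$. -}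

module Defs where

open import Level using (Level; _⊔_) renaming (suc to lsuc)
open import Algebra.Bundles using (CommutativeRing)
open import Data.Nat using (ℕ; zero; suc; _∸_)
open import Data.Fin using (Fin; zero; suc; toℕ; fromℕ; inject₁)
open import Data.List using (List; []; _∷_; foldr; replicate; _++_)
open import Data.Vec using (Vec; toList)
open import Data.Product using (∃)
open import Relation.Nullary using (¬_)
open import Relation.Binary.Definitions using (Decidable)

record FiniteField (c ℓ : Level) : Set (lsuc (c ⊔ ℓ)) where
  field
    commutativeRing : CommutativeRing c ℓ
  open CommutativeRing commutativeRing public
  field
    0≉1       : ¬ (0# ≈ 1#)
    inverse   : ∀ x → ¬ (x ≈ 0#) → ∃ λ y → x * y ≈ 1#
    _≟_       : Decidable _≈_
    size      : ℕ
    enum      : Fin size → Carrier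
    enum-surj : ∀ x → ∃ λ i → enum i ≈ x

module Poly {c ℓ : Level} (F : FiniteField c ℓ) where
  open FiniteField F public using (Carrier; _≈_; 0#)
  open FiniteField F using (_+_; _*_; -_; _-_; 1#)

  -- Univariate polynomials over F as coefficient lists, lowest degree first.
  Pol : Set c
  Pol = List Carrier

  coeff : Pol → ℕ → Carrier
  coeff []       _       = 0#
  coeff (a ∷ p)  zero    = a
  coeff (a ∷ p)  (suc i) = coeff p i

  _⊕_ : Pol → Pol → Pol
  []      ⊕ q       = q
  (a ∷ p) ⊕ []      = a ∷ p
  (a ∷ p) ⊕ (b ∷ q) = (a + b) ∷ (p ⊕ q)

  scale : Carrier → Pol → Pol
  scale k []      = []
  scale k (a ∷ p) = (k * a) ∷ scale k p

  _⊗_ : Pol → Pol → Pol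
  []      ⊗ q = []
  (a ∷ p) ⊗ q = scale a q ⊕ (0# ∷ (p ⊗ q))

  eval : Pol → Carrier → Carrier
  eval p x = foldr (λ a acc → a + x * acc) 0# p

  prodLin : (r : ℕ) → (Fin r → Carrier) → Pol
  prodLin zero    x = 1# ∷ []
  prodLin (suc r) x = ((- x zero) ∷ 1# ∷ []) ⊗ prodLin r (λ i → x (suc i))

  -- Residues modulo a monic polynomial T^r + Σ_{i<r} q_i T^i, represented by
  -- their r coefficients (Fin r → Carrier), i.e. polynomials of degree ≤ r-1.
  -- mulT R = T·R reduced modulo the monic polynomial.
  mulT : (r : ℕ) → (ℕ → Carrier) → (Fin r → Carrier) → Fin r → Carrier
  mulT (suc r) q R zero    = - (R (fromℕ r) * q 0)
  mulT (suc r) q R (suc i) = R (inject₁ i) - R (fromℕ r) * q (suc (toℕ i))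

  addConst : (r : ℕ) → Carrier → (Fin r → Carrier) → Fin r → Carrier
  addConst (suc r) a R zero    = a + R zero
  addConst (suc r) a R (suc i) = R (suc i)

  -- remMonic r Q f : coefficients of the remainder of f modulo the monic
  -- polynomial Q of degree r (division algorithm, Horner-style).
  remMonic : (r : ℕ) → Pol → Pol → Fin r → Carrier
  remMonic r Q f = foldr (λ a acc → addConst r a (mulT r (coeff Q) acc)) (λ _ → 0#) f

  -- f_a = T^d + a_{d-1} T^{d-1} + ⋯ + a_{d-s} T^{d-s}, where the vector
  -- a : Vec Carrier s lists (a_{d-s}, …, a_{d-1}) (lowest degree first).
  fa : (d s : ℕ) → Vec Carrier s → Pol
  fa d s a = replicate (d ∸ s) 0# ++ (toList a ++ (1# ∷ []))

  -- R_j^a(x_1,…,x_r): the j-th coefficient of R_a = f_a mod (T-X_1)⋯(T-X_r),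
  -- specialised at X_i = x_i.
  Rcoeff : (d s r : ℕ) → Vec Carrier s → (Fin r → Carrier) → Fin r → Carrier
  Rcoeff d s r a x = remMonic r (prodLin r x) (fa d s a)

module Submission where

-- Let m = d ∸ s, let Q = (T - x_1)⋯(T - x_r) and let R be the remainder of
-- f = f_a modulo Q.  The argument rests on two general facts.
--  (1) Remainder evaluation: if y is a root of a monic polynomial Q, then the
--      remainder of any f modulo Q takes the value f(y) at y.  (remMonic runs
--      Horner's scheme for f inside F[T]/(Q), and evaluation at y respects the
--      reduction T·R ↦ T·R mod Q.)
--  (2) Root counting: a polynomial with at most n coefficients vanishing at
--      n distinct points of a field is zero.  (Factor off T - x_1 by synthetic
--      division; the quotient vanishes at the remaining points because a field
--      has no zero divisors; induct on n.)
-- If g has degree < m and (f + g)(x_i) = 0 for all i, then by (1) the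
-- polynomial R + g has at most r coefficients and vanishes at every x_i,
-- so it is zero by (2); as g has no coefficients in degrees ≥ m, R_j = 0 for
-- m ≤ j < r.  Conversely, if these R_j vanish, g := -(R_0 + ⋯ + R_{m-1}T^{m-1})
-- satisfies (f + g)(x_i) = R(x_i) + g(x_i) = 0 by (1).

open import Defs
open import Level using (Level)
open import Function using (_∘_)
open import Data.Nat using (ℕ; zero; suc; z≤n; s≤s; _<_; _≤_; _∸_; _<?_)
import Data.Nat.Properties as ℕ
open import Data.Fin using (Fin; toℕ; fromℕ; inject₁)
import Data.Fin as Fin
import Data.Fin.Properties as Fin
open import Data.Vec using (Vec; toList; tabulate)
import Data.Vec as Vec
open import Data.List using ([]; _∷_)
open import Data.Product using (Σ; _×_; _,_; proj₁; proj₂)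
open import Relation.Nullary using (¬_; yes; no)
open import Relation.Binary.PropositionalEquality as ≡ using (_≡_)

module Interpolation {c ℓ : Level} (F : FiniteField c ℓ) where
  open FiniteField F hiding (zero)
  open Poly F using (Pol; coeff; _⊕_; scale; _⊗_; eval; prodLin; mulT; addConst; remMonic)
  open import Algebra.Properties.Ring ring using (+-inverseˡ-unique; x∙y⁻¹≈ε⇒x≈y)
  open import Algebra.Properties.Semiring.Exp semiring using (_^_)
  open import Algebra.Solver.Ring.NaturalCoefficients.Default commutativeSemiring
  open import Relation.Binary.Reasoning.Setoid setoid

  +-zero-right : ∀ {x z} → z ≈ 0# → x ≈ x + z
  +-zero-right {x} z≈0 = sym (trans (+-cong refl z≈0) (+-identityʳ x))

  +-cancel-right : ∀ a b b′ → b ≈ b′ → a ≈ (a + b) - b′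
  +-cancel-right a b b′ b≈b′ = begin
    a                ≈⟨ +-zero-right (-‿inverseʳ b′) ⟩
    a + (b′ - b′)    ≈⟨ +-cong refl (+-cong (sym b≈b′) refl) ⟩
    a + (b - b′)     ≈⟨ +-assoc a b (- b′) ⟨
    (a + b) - b′     ∎

  difference-vanishes : ∀ {a b} z → a ≈ 0# → b ≈ 0# → a - z * b ≈ 0#
  difference-vanishes z a≈0 b≈0 =
    trans (+-cong a≈0 (-‿cong (trans (*-cong refl b≈0) (zeroʳ z)))) (-‿inverseʳ 0#)

  no-zero-divisors : ∀ a b → ¬ (a ≈ 0#) → a * b ≈ 0# → b ≈ 0#
  no-zero-divisors a b a≉0 ab≈0 with inverse a a≉0
  ... | a⁻¹ , aa⁻¹≈1 = begin
    b              ≈⟨ sym (*-identityˡ b) ⟩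
    1# * b         ≈⟨ *-cong (sym aa⁻¹≈1) refl ⟩
    (a * a⁻¹) * b  ≈⟨ solve 3 (λ a a⁻¹ b → (a :* a⁻¹) :* b := a⁻¹ :* (a :* b)) refl a a⁻¹ b ⟩
    a⁻¹ * (a * b)  ≈⟨ *-cong refl ab≈0 ⟩
    a⁻¹ * 0#       ≈⟨ zeroʳ a⁻¹ ⟩
    0#             ∎

  horner : ℕ → (ℕ → Carrier) → Carrier → Carrier
  horner zero    c y = 0#
  horner (suc n) c y = c 0 + y * horner n (c ∘ suc) y

  VanishesFrom : ℕ → (ℕ → Carrier) → Set ℓ
  VanishesFrom m c = ∀ i → m ≤ i → c i ≈ 0#

  horner-cong : ∀ n {c c′} y → (∀ i → i < n → c i ≈ c′ i) → horner n c y ≈ horner n c′ y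
  horner-cong zero    y c≈c′ = refl
  horner-cong (suc n) y c≈c′ =
    +-cong (c≈c′ 0 (s≤s z≤n)) (*-cong refl (horner-cong n y (λ i i<n → c≈c′ (suc i) (s≤s i<n))))

  horner-zero : ∀ n {c} y → (∀ i → c i ≈ 0#) → horner n c y ≈ 0#
  horner-zero zero    y c≈0 = refl
  horner-zero (suc n) {c} y c≈0 = begin
    c 0 + y * horner n (c ∘ suc) y ≈⟨ +-cong (c≈0 0) (*-cong refl (horner-zero n y (c≈0 ∘ suc))) ⟩
    0# + y * 0#                    ≈⟨ +-identityˡ _ ⟩
    y * 0#                         ≈⟨ zeroʳ y ⟩
    0#                             ∎

  horner-truncate : ∀ {m} n c y → m ≤ n → VanishesFrom m c → horner n c y ≈ horner m c y
  horner-truncate {zero}  n       c y _       c≈0 = horner-zero n y (λ i → c≈0 i z≤n)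
  horner-truncate {suc m} (suc n) c y (s≤s m≤n) c≈0 =
    +-cong refl (*-cong refl (horner-truncate n (c ∘ suc) y m≤n (λ i m≤i → c≈0 (suc i) (s≤s m≤i))))

  horner-+ : ∀ n c c′ y → horner n (λ i → c i + c′ i) y ≈ horner n c y + horner n c′ y
  horner-+ zero    c c′ y = sym (+-identityʳ 0#)
  horner-+ (suc n) c c′ y =
    trans (+-cong refl (*-cong refl (horner-+ n (c ∘ suc) (c′ ∘ suc) y)))
          (solve 5 (λ a b y A B → (a :+ b) :+ y :* (A :+ B) := (a :+ y :* A) :+ (b :+ y :* B))
                   refl (c 0) (c′ 0) y _ _)

  horner-scale : ∀ n k c y → horner n (λ i → k * c i) y ≈ k * horner n c y
  horner-scale zero    k c y = sym (zeroʳ k)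
  horner-scale (suc n) k c y =
    trans (+-cong refl (*-cong refl (horner-scale n k (c ∘ suc) y)))
          (solve 4 (λ k a y A → k :* a :+ y :* (k :* A) := k :* (a :+ y :* A)) refl k (c 0) y _)

  horner-neg : ∀ n c y → horner n (λ i → - c i) y ≈ - horner n c y
  horner-neg n c y = +-inverseˡ-unique _ _ (begin
    horner n (λ i → - c i) y + horner n c y ≈⟨ horner-+ n (λ i → - c i) c y ⟨
    horner n (λ i → - c i + c i) y          ≈⟨ horner-zero n y (λ i → -‿inverseˡ (c i)) ⟩
    0#                                      ∎)

  horner-last : ∀ n c y → horner (suc n) c y ≈ horner n c y + c n * y ^ n
  horner-last zero    c y = solve 2 (λ c₀ y → c₀ :+ y :* con 0 := con 0 :+ c₀ :* con 1) refl (c 0) y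
  horner-last (suc n) c y = begin
    c 0 + y * horner (suc n) (c ∘ suc) y
      ≈⟨ +-cong refl (*-cong refl (horner-last n (c ∘ suc) y)) ⟩
    c 0 + y * (horner n (c ∘ suc) y + c (suc n) * y ^ n)
      ≈⟨ solve 5 (λ c₀ y A cₙ P → c₀ :+ y :* (A :+ cₙ :* P) := (c₀ :+ y :* A) :+ cₙ :* (y :* P))
                 refl (c 0) y _ (c (suc n)) (y ^ n) ⟩
    (c 0 + y * horner n (c ∘ suc) y) + c (suc n) * (y * y ^ n) ∎

  coeff-⊕ : ∀ p q i → coeff (p ⊕ q) i ≈ coeff p i + coeff q i
  coeff-⊕ []      q       i       = sym (+-identityˡ _)
  coeff-⊕ (a ∷ p) []      i       = sym (+-identityʳ _)
  coeff-⊕ (a ∷ p) (b ∷ q) zero    = refl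
  coeff-⊕ (a ∷ p) (b ∷ q) (suc i) = coeff-⊕ p q i

  coeff-scale : ∀ k p i → coeff (scale k p) i ≈ k * coeff p i
  coeff-scale k []      i       = sym (zeroʳ k)
  coeff-scale k (a ∷ p) zero    = refl
  coeff-scale k (a ∷ p) (suc i) = coeff-scale k p i

  coeff-vector : ∀ {m} (g : Vec Carrier m) → VanishesFrom m (coeff (toList g))
  coeff-vector Vec.[]      i       _         = refl
  coeff-vector (b Vec.∷ g) (suc i) (s≤s m≤i) = coeff-vector g i m≤i

  eval-horner : ∀ p n y → VanishesFrom n (coeff p) → eval p y ≈ horner n (coeff p) y
  eval-horner []      n       y _   = sym (horner-zero n y (λ _ → refl))
  eval-horner (a ∷ p) zero    y p≈0 = begin
    a + y * eval p y ≈⟨ +-cong (p≈0 0 z≤n) (*-cong refl (eval-horner p 0 y (λ i _ → p≈0 (suc i) z≤n))) ⟩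
    0# + y * 0#      ≈⟨ +-identityˡ _ ⟩
    y * 0#           ≈⟨ zeroʳ y ⟩
    0#               ∎
  eval-horner (a ∷ p) (suc n) y p≈0 =
    +-cong refl (*-cong refl (eval-horner p n y (λ i n≤i → p≈0 (suc i) (s≤s n≤i))))

  eval-tabulate : ∀ n (c : ℕ → Carrier) y → eval (toList (tabulate {n = n} (c ∘ toℕ))) y ≈ horner n c y
  eval-tabulate zero    c y = refl
  eval-tabulate (suc n) c y = +-cong refl (*-cong refl (eval-tabulate n (c ∘ suc) y))

  eval-⊕ : ∀ p q y → eval (p ⊕ q) y ≈ eval p y + eval q y
  eval-⊕ []      q       y = sym (+-identityˡ _)
  eval-⊕ (a ∷ p) []      y = sym (+-identityʳ _)
  eval-⊕ (a ∷ p) (b ∷ q) y =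
    trans (+-cong refl (*-cong refl (eval-⊕ p q y)))
          (solve 5 (λ a b y A B → (a :+ b) :+ y :* (A :+ B) := (a :+ y :* A) :+ (b :+ y :* B))
                   refl a b y _ _)

  eval-scale : ∀ k p y → eval (scale k p) y ≈ k * eval p y
  eval-scale k []      y = sym (zeroʳ k)
  eval-scale k (a ∷ p) y =
    trans (+-cong refl (*-cong refl (eval-scale k p y)))
          (solve 4 (λ k a y A → k :* a :+ y :* (k :* A) := k :* (a :+ y :* A)) refl k a y _)

  eval-⊗ : ∀ p q y → eval (p ⊗ q) y ≈ eval p y * eval q y
  eval-⊗ []      q y = sym (zeroˡ _)
  eval-⊗ (a ∷ p) q y = begin
    eval (scale a q ⊕ (0# ∷ (p ⊗ q))) y
      ≈⟨ eval-⊕ (scale a q) (0# ∷ (p ⊗ q)) y ⟩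
    eval (scale a q) y + (0# + y * eval (p ⊗ q) y)
      ≈⟨ +-cong (eval-scale a q y) (+-cong refl (*-cong refl (eval-⊗ p q y))) ⟩
    a * eval q y + (0# + y * (eval p y * eval q y))
      ≈⟨ solve 4 (λ a Q y P → a :* Q :+ (con 0 :+ y :* (P :* Q)) := (a :+ y :* P) :* Q)
                 refl a (eval q y) y (eval p y) ⟩
    (a + y * eval p y) * eval q y ∎

  prodLin-root : ∀ r (x : Fin r → Carrier) i → eval (prodLin r x) (x i) ≈ 0#
  prodLin-root (suc r) x i = trans (eval-⊗ linear rest (x i)) (factor-vanishes i)
    where
    linear rest : Pol
    linear = (- x Fin.zero) ∷ 1# ∷ []
    rest   = prodLin r (x ∘ Fin.suc)
    factor-vanishes : ∀ i → eval linear (x i) * eval rest (x i) ≈ 0#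
    factor-vanishes Fin.zero = trans (*-cong linear-root refl) (zeroˡ _)
      where
      z : Carrier
      z = x Fin.zero
      linear-root : - z + z * (1# + z * 0#) ≈ 0#
      linear-root = trans (solve 2 (λ w z → w :+ z :* (con 1 :+ z :* con 0) := w :+ z) refl (- z) z)
                          (-‿inverseˡ z)
    factor-vanishes (Fin.suc i) = trans (*-cong refl (prodLin-root r (x ∘ Fin.suc) i)) (zeroʳ _)

  coeff-linear-⊗ : ∀ a q j → coeff ((a ∷ 1# ∷ []) ⊗ q) (suc j) ≈ a * coeff q (suc j) + coeff q j
  coeff-linear-⊗ a q j = begin
    coeff (scale a q ⊕ (0# ∷ (scale 1# q ⊕ (0# ∷ [])))) (suc j)
      ≈⟨ coeff-⊕ (scale a q) _ (suc j) ⟩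
    coeff (scale a q) (suc j) + coeff (scale 1# q ⊕ (0# ∷ [])) j
      ≈⟨ +-cong (coeff-scale a q (suc j)) (coeff-⊕ (scale 1# q) _ j) ⟩
    a * coeff q (suc j) + (coeff (scale 1# q) j + coeff (0# ∷ []) j)
      ≈⟨ +-cong refl (+-cong (trans (coeff-scale 1# q j) (*-identityˡ _)) (coeff-zero j)) ⟩
    a * coeff q (suc j) + (coeff q j + 0#)
      ≈⟨ +-cong refl (+-identityʳ _) ⟩
    a * coeff q (suc j) + coeff q j ∎
    where
    coeff-zero : ∀ j → coeff (0# ∷ []) j ≈ 0#
    coeff-zero zero    = refl
    coeff-zero (suc j) = refl

  prodLin-monic : ∀ r (x : Fin r → Carrier) →
    coeff (prodLin r x) r ≈ 1# × VanishesFrom (suc r) (coeff (prodLin r x))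
  prodLin-monic zero    x = refl , λ { (suc i) _ → refl }
  prodLin-monic (suc r) x = leading , vanishes
    where
    q : Pol
    q = prodLin r (x ∘ Fin.suc)
    a : Carrier
    a = - x Fin.zero
    ih : coeff q r ≈ 1# × VanishesFrom (suc r) (coeff q)
    ih = prodLin-monic r (x ∘ Fin.suc)
    leading : coeff (prodLin (suc r) x) (suc r) ≈ 1#
    leading = begin
      coeff (prodLin (suc r) x) (suc r) ≈⟨ coeff-linear-⊗ a q r ⟩
      a * coeff q (suc r) + coeff q r   ≈⟨ +-cong (*-cong refl (proj₂ ih (suc r) ℕ.≤-refl)) (proj₁ ih) ⟩
      a * 0# + 1#                       ≈⟨ +-cong (zeroʳ a) refl ⟩
      0# + 1#                           ≈⟨ +-identityˡ 1# ⟩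
      1#                                ∎
    vanishes : VanishesFrom (suc (suc r)) (coeff (prodLin (suc r) x))
    vanishes (suc i) (s≤s r<i) = begin
      coeff (prodLin (suc r) x) (suc i) ≈⟨ coeff-linear-⊗ a q i ⟩
      a * coeff q (suc i) + coeff q i   ≈⟨ +-cong (*-cong refl (proj₂ ih (suc i) (ℕ.m≤n⇒m≤1+n r<i))) (proj₂ ih i r<i) ⟩
      a * 0# + 0#                       ≈⟨ +-identityʳ _ ⟩
      a * 0#                            ≈⟨ zeroʳ a ⟩
      0#                                ∎

  monic-eval : ∀ r Q y → coeff Q r ≈ 1# → VanishesFrom (suc r) (coeff Q) →
    eval Q y ≈ horner r (coeff Q) y + y ^ r
  monic-eval r Q y leading vanishes = begin
    eval Q y                                  ≈⟨ eval-horner Q (suc r) y vanishes ⟩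
    horner (suc r) (coeff Q) y                ≈⟨ horner-last r (coeff Q) y ⟩
    horner r (coeff Q) y + coeff Q r * y ^ r  ≈⟨ +-cong refl (trans (*-cong leading refl) (*-identityˡ _)) ⟩
    horner r (coeff Q) y + y ^ r              ∎

  extend : (n : ℕ) → (Fin n → Carrier) → ℕ → Carrier
  extend zero    R j       = 0#
  extend (suc n) R zero    = R Fin.zero
  extend (suc n) R (suc j) = extend n (R ∘ Fin.suc) j

  extend-toℕ : ∀ n R (k : Fin n) → extend n R (toℕ k) ≡ R k
  extend-toℕ (suc n) R Fin.zero    = ≡.refl
  extend-toℕ (suc n) R (Fin.suc k) = extend-toℕ n (R ∘ Fin.suc) k

  extend-agrees : ∀ n R (c : ℕ → Carrier) → (∀ k → R k ≈ c (toℕ k)) → ∀ i → i < n → extend n R i ≈ c i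
  extend-agrees (suc n) R c R≈c zero    _         = R≈c Fin.zero
  extend-agrees (suc n) R c R≈c (suc i) (s≤s i<n) =
    extend-agrees n (R ∘ Fin.suc) (c ∘ suc) (R≈c ∘ Fin.suc) i i<n

  extend-zero : ∀ n i → extend n (λ _ → 0#) i ≈ 0#
  extend-zero zero    i       = refl
  extend-zero (suc n) zero    = refl
  extend-zero (suc n) (suc i) = extend-zero n i

  extend-vanishes : ∀ n (R : Fin n → Carrier) m → (∀ k → m ≤ toℕ k → R k ≈ 0#) → VanishesFrom m (extend n R)
  extend-vanishes zero    R m       R≈0 i       _         = refl
  extend-vanishes (suc n) R zero    R≈0 zero    _         = R≈0 Fin.zero z≤n
  extend-vanishes (suc n) R zero    R≈0 (suc i) _         =
    extend-vanishes n (R ∘ Fin.suc) zero (λ k _ → R≈0 (Fin.suc k) z≤n) i z≤n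
  extend-vanishes (suc n) R (suc m) R≈0 (suc i) (s≤s m≤i) =
    extend-vanishes n (R ∘ Fin.suc) m (λ k m≤k → R≈0 (Fin.suc k) (s≤s m≤k)) i m≤i

  evalResidue : (n : ℕ) → (Fin n → Carrier) → Carrier → Carrier
  evalResidue n R y = horner n (extend n R) y

  -- Fix a monic Q = T^{r+1} + Σ_{i≤r} q_i T^i and a root y of Q.  Then
  -- evaluation at y turns the residue operations mulT and addConst into
  -- multiplication by y and addition, hence the remainder of f evaluates to f(y).
  module RemainderAtRoot (r : ℕ) (Q : Pol) (y : Carrier)
                         (root : horner (suc r) (coeff Q) y + y ^ suc r ≈ 0#) where
    q : ℕ → Carrier
    q = coeff Q

    shiftUp : (Fin (suc r) → Carrier) → ℕ → Carrier
    shiftUp R zero    = 0#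
    shiftUp R (suc j) = extend (suc r) R j

    mulT-coeff : ∀ R (k : Fin (suc r)) → mulT (suc r) q R k ≈ shiftUp R (toℕ k) - R (fromℕ r) * q (toℕ k)
    mulT-coeff R Fin.zero    = sym (+-identityˡ _)
    mulT-coeff R (Fin.suc k) = +-cong (begin
      R (inject₁ k)                      ≡⟨ extend-toℕ (suc r) R (inject₁ k) ⟨
      extend (suc r) R (toℕ (inject₁ k)) ≡⟨ ≡.cong (extend (suc r) R) (Fin.toℕ-inject₁ k) ⟩
      extend (suc r) R (toℕ k)           ∎) refl

    mulT-eval : ∀ R → evalResidue (suc r) (mulT (suc r) q R) y ≈ y * evalResidue (suc r) R y
    mulT-eval R = begin
      horner (suc r) (extend (suc r) (mulT (suc r) q R)) y
        ≈⟨ horner-cong (suc r) y (extend-agrees (suc r) _ (λ i → shiftUp R i - B * q i) (mulT-coeff R)) ⟩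
      horner (suc r) (λ i → shiftUp R i - B * q i) y
        ≈⟨ horner-+ (suc r) (shiftUp R) (λ i → - (B * q i)) y ⟩
      horner (suc r) (shiftUp R) y + horner (suc r) (λ i → - (B * q i)) y
        ≈⟨ +-cong refl (trans (horner-neg (suc r) (λ i → B * q i) y) (-‿cong (horner-scale (suc r) B q y))) ⟩
      (0# + y * A) - B * C
        ≈⟨ +-zero-right (trans (*-cong refl root) (zeroʳ B)) ⟩
      ((0# + y * A) - B * C) + B * (C + y * P)
        ≈⟨ solve 6 (λ y A w B C P → ((con 0 :+ y :* A) :+ w) :+ B :* (C :+ y :* P)
                                    := y :* (A :+ B :* P) :+ (w :+ B :* C)) refl y A (- (B * C)) B C P ⟩
      y * (A + B * P) + (- (B * C) + B * C)
        ≈⟨ +-zero-right (-‿inverseˡ (B * C)) ⟨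
      y * (A + B * P)
        ≈⟨ *-cong refl (trans (horner-last r (extend (suc r) R) y) (+-cong refl (*-cong top refl))) ⟨
      y * evalResidue (suc r) R y ∎
      where
      B A C P : Carrier
      B = R (fromℕ r)
      A = horner r (extend (suc r) R) y
      C = horner (suc r) q y
      P = y ^ r
      top : extend (suc r) R r ≈ B
      top = begin
        extend (suc r) R r                ≡⟨ ≡.cong (extend (suc r) R) (Fin.toℕ-fromℕ r) ⟨
        extend (suc r) R (toℕ (fromℕ r))  ≡⟨ extend-toℕ (suc r) R (fromℕ r) ⟩
        B                                 ∎

    addConst-eval : ∀ a R → evalResidue (suc r) (addConst (suc r) a R) y ≈ a + evalResidue (suc r) R y
    addConst-eval a R = +-assoc a (R Fin.zero) _

    remainder-eval : ∀ f → evalResidue (suc r) (remMonic (suc r) Q f) y ≈ eval f y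
    remainder-eval []      = horner-zero (suc r) y (extend-zero (suc r))
    remainder-eval (a ∷ f) = begin
      evalResidue (suc r) (addConst (suc r) a (mulT (suc r) q R)) y ≈⟨ addConst-eval a (mulT (suc r) q R) ⟩
      a + evalResidue (suc r) (mulT (suc r) q R) y                 ≈⟨ +-cong refl (mulT-eval R) ⟩
      a + y * evalResidue (suc r) R y                               ≈⟨ +-cong refl (*-cong refl (remainder-eval f)) ⟩
      a + y * eval f y                                              ∎
      where
      R : Fin (suc r) → Carrier
      R = remMonic (suc r) Q f

  remainder-at-nodes : ∀ r (x : Fin (suc r) → Carrier) f i →
    evalResidue (suc r) (remMonic (suc r) (prodLin (suc r) x) f) (x i) ≈ eval f (x i)
  remainder-at-nodes r x f i = RemainderAtRoot.remainder-eval r Q (x i) root f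
    where
    Q : Pol
    Q = prodLin (suc r) x
    root : horner (suc r) (coeff Q) (x i) + x i ^ suc r ≈ 0#
    root with prodLin-monic (suc r) x
    ... | leading , vanishes =
      trans (sym (monic-eval (suc r) Q (x i) leading vanishes)) (prodLin-root (suc r) x i)

  -- Synthetic division by T - z: the j-th coefficient of the quotient of
  -- Σ_{i≤n} c_i T^i by T - z is Σ_k c_{j+1+k} z^k.
  quotient : ℕ → (ℕ → Carrier) → Carrier → ℕ → Carrier
  quotient zero    c z j       = 0#
  quotient (suc n) c z zero    = horner (suc n) (c ∘ suc) z
  quotient (suc n) c z (suc j) = quotient n (c ∘ suc) z j

  quotient-head : ∀ n c z → quotient n c z 0 ≈ horner n (c ∘ suc) z
  quotient-head zero    c z = refl
  quotient-head (suc n) c z = refl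

  quotient-vanishes : ∀ n c z → VanishesFrom n (quotient n c z)
  quotient-vanishes zero    c z j       _         = refl
  quotient-vanishes (suc n) c z (suc j) (s≤s n≤j) = quotient-vanishes n (c ∘ suc) z j n≤j

  factor-theorem : ∀ n c y z → horner (suc n) c y ≈ (y - z) * horner n (quotient n c z) y + horner (suc n) c z
  factor-theorem zero    c y z =
    solve 4 (λ c₀ y w z → c₀ :+ y :* con 0 := (y :+ w) :* con 0 :+ (c₀ :+ z :* con 0)) refl (c 0) y (- z) z
  factor-theorem (suc n) c y z = begin
    c 0 + y * horner (suc n) (c ∘ suc) y
      ≈⟨ +-cong refl (*-cong refl (factor-theorem n (c ∘ suc) y z)) ⟩
    c 0 + y * ((y - z) * Qy + ρ)
      ≈⟨ +-zero-right (trans (*-cong (-‿inverseˡ z) refl) (zeroˡ ρ)) ⟩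
    c 0 + y * ((y - z) * Qy + ρ) + (- z + z) * ρ
      ≈⟨ solve 6 (λ c₀ y w z Qy ρ → c₀ :+ y :* ((y :+ w) :* Qy :+ ρ) :+ (w :+ z) :* ρ
                                   := (y :+ w) :* (ρ :+ y :* Qy) :+ (c₀ :+ z :* ρ))
                 refl (c 0) y (- z) z Qy ρ ⟩
    (y - z) * (ρ + y * Qy) + (c 0 + z * ρ) ∎
    where
    Qy ρ : Carrier
    Qy = horner n (quotient n (c ∘ suc) z) y
    ρ  = horner (suc n) (c ∘ suc) z

  coefficient-head : ∀ n c z → c 0 ≈ horner (suc n) c z - z * quotient n c z 0
  coefficient-head n c z = +-cancel-right (c 0) _ _ (*-cong refl (sym (quotient-head n c z)))

  coefficient-tail : ∀ n c z j → j < n → c (suc j) ≈ quotient n c z j - z * quotient n c z (suc j)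
  coefficient-tail (suc n) c z zero    _         =
    +-cancel-right (c 1) _ _ (*-cong refl (sym (quotient-head n (c ∘ suc) z)))
  coefficient-tail (suc n) c z (suc j) (s≤s j<n) = coefficient-tail n (c ∘ suc) z j j<n

  root-count : ∀ n c (x : Fin n → Carrier) → (∀ i j → x i ≈ x j → i ≡ j) →
    (∀ i → horner n c (x i) ≈ 0#) → ∀ j → j < n → c j ≈ 0#
  root-count (suc n) c x x-injective c-roots = coefficients-vanish
    where
    z : Carrier
    z = x Fin.zero
    q : ℕ → Carrier
    q = quotient n c z

    quotient-roots : ∀ i → horner n q (x (Fin.suc i)) ≈ 0#
    quotient-roots i = no-zero-divisors (w - z) _ w-z≉0 (begin
      (w - z) * horner n q w                          ≈⟨ +-zero-right (c-roots Fin.zero) ⟩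
      (w - z) * horner n q w + horner (suc n) c z     ≈⟨ factor-theorem n c w z ⟨
      horner (suc n) c w                              ≈⟨ c-roots (Fin.suc i) ⟩
      0#                                              ∎)
      where
      w : Carrier
      w = x (Fin.suc i)
      w-z≉0 : ¬ (w - z ≈ 0#)
      w-z≉0 w-z≈0 with x-injective (Fin.suc i) Fin.zero (x∙y⁻¹≈ε⇒x≈y w z w-z≈0)
      ... | ()

    quotient-zero : ∀ j → q j ≈ 0#
    quotient-zero j with j <? n
    ... | yes j<n = root-count n q (x ∘ Fin.suc)
                      (λ i j xi≈xj → Fin.suc-injective (x-injective (Fin.suc i) (Fin.suc j) xi≈xj))
                      quotient-roots j j<n
    ... | no  j≮n = quotient-vanishes n c z j (ℕ.≮⇒≥ j≮n)

    coefficients-vanish : ∀ j → j < suc n → c j ≈ 0#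
    coefficients-vanish zero    _         =
      trans (coefficient-head n c z) (difference-vanishes z (c-roots Fin.zero) (quotient-zero 0))
    coefficients-vanish (suc j) (s≤s j<n) =
      trans (coefficient-tail n c z j j<n) (difference-vanishes z (quotient-zero j) (quotient-zero (suc j)))

  -- Fix nodes x_1, …, x_{r+1}, a polynomial f, its remainder R modulo
  -- (T - x_1)⋯(T - x_{r+1}), and a degree bound m ≤ r + 1.  Distinctness of
  -- the nodes is needed only for the first direction.
  module Criterion (r : ℕ) (x : Fin (suc r) → Carrier) (f : Pol) {m : ℕ} (m≤r : m ≤ suc r) where
    R : Fin (suc r) → Carrier
    R = remMonic (suc r) (prodLin (suc r) x) f

    Correctable : Set (c Level.⊔ ℓ)
    Correctable = Σ (Vec Carrier m) λ g → ∀ i → eval (f ⊕ toList g) (x i) ≈ 0#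

    HighRemainderVanishes : Set ℓ
    HighRemainderVanishes = ∀ (j : Fin (suc r)) → m ≤ toℕ j → R j ≈ 0#

    -- For distinct nodes, R + g has fewer than r + 1 coefficients and
    -- vanishes at the r + 1 nodes, so it is zero; above degree m it is R.
    correctable⇒high-remainder-vanishes : (∀ i j → x i ≈ x j → i ≡ j) → Correctable → HighRemainderVanishes
    correctable⇒high-remainder-vanishes x-injective (g , f+g-roots) j m≤j = begin
      R j                                      ≡⟨ extend-toℕ (suc r) R j ⟨
      extend (suc r) R (toℕ j)                 ≈⟨ +-zero-right (coeff-vector g (toℕ j) m≤j) ⟩
      extend (suc r) R (toℕ j) + coeff g′ (toℕ j)
        ≈⟨ root-count (suc r) R+g x x-injective R+g-roots (toℕ j) (Fin.toℕ<n j) ⟩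
      0#                                       ∎
      where
      g′ : Pol
      g′ = toList g
      R+g : ℕ → Carrier
      R+g i = extend (suc r) R i + coeff g′ i
      R+g-roots : ∀ i → horner (suc r) R+g (x i) ≈ 0#
      R+g-roots i = begin
        horner (suc r) R+g (x i)
          ≈⟨ horner-+ (suc r) (extend (suc r) R) (coeff g′) (x i) ⟩
        evalResidue (suc r) R (x i) + horner (suc r) (coeff g′) (x i)
          ≈⟨ +-cong (remainder-at-nodes r x f i)
                    (horner-truncate (suc r) (coeff g′) (x i) m≤r (coeff-vector g)) ⟩
        eval f (x i) + horner m (coeff g′) (x i)
          ≈⟨ +-cong refl (eval-horner g′ m (x i) (coeff-vector g)) ⟨
        eval f (x i) + eval g′ (x i)
          ≈⟨ eval-⊕ f g′ (x i) ⟨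
        eval (f ⊕ g′) (x i)
          ≈⟨ f+g-roots i ⟩
        0#                                     ∎

    high-remainder-vanishes⇒correctable : HighRemainderVanishes → Correctable
    high-remainder-vanishes⇒correctable high-vanishes = g , f+g-roots
      where
      low-negated : ℕ → Carrier
      low-negated j = - extend (suc r) R j
      g : Vec Carrier m
      g = tabulate (low-negated ∘ toℕ)
      f+g-roots : ∀ i → eval (f ⊕ toList g) (x i) ≈ 0#
      f+g-roots i = begin
        eval (f ⊕ toList g) (x i)
          ≈⟨ eval-⊕ f (toList g) (x i) ⟩
        eval f (x i) + eval (toList g) (x i)
          ≈⟨ +-cong (sym (remainder-at-nodes r x f i)) (eval-tabulate m low-negated (x i)) ⟩
        evalResidue (suc r) R (x i) + horner m low-negated (x i)
          ≈⟨ +-cong (horner-truncate (suc r) _ (x i) m≤r (extend-vanishes (suc r) R m high-vanishes))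
                    (horner-neg m (extend (suc r) R) (x i)) ⟩
        horner m (extend (suc r) R) (x i) - horner m (extend (suc r) R) (x i)
          ≈⟨ -‿inverseʳ _ ⟩
        0#                                     ∎

  interpolation-criterion : ∀ {m} r → m ≤ r → (f : Pol) (x : Fin r → Carrier) →
    (∀ i j → x i ≈ x j → i ≡ j) →
    ((Σ (Vec Carrier m) λ g → ∀ i → eval (f ⊕ toList g) (x i) ≈ 0#) →
      (∀ (j : Fin r) → m ≤ toℕ j → remMonic r (prodLin r x) f j ≈ 0#))
    × ((∀ (j : Fin r) → m ≤ toℕ j → remMonic r (prodLin r x) f j ≈ 0#) →
      (Σ (Vec Carrier m) λ g → ∀ i → eval (f ⊕ toList g) (x i) ≈ 0#))
  interpolation-criterion zero    z≤n f x _ = (λ _ ()) , (λ _ → Vec.[] , λ ())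
  interpolation-criterion (suc r) m≤r f x x-injective =
    correctable⇒high-remainder-vanishes x-injective , high-remainder-vanishes⇒correctable
    where open Criterion r x f m≤r

open import Data.Nat using (_+_)

lemma2p2 : {c ℓ : Level} (F : FiniteField c ℓ) →
    let open Poly F in
    (d s r : ℕ) → 1 ≤ s → s + 2 ≤ d → (d ∸ s) + 1 ≤ r → r ≤ d →
    (a : Vec Carrier s) →
    (x : Fin r → Carrier) → (∀ i j → x i ≈ x j → i ≡ j) →
    ((Σ (Vec Carrier (d ∸ s)) λ g → ∀ i → eval (fa d s a ⊕ toList g) (x i) ≈ 0#) →
    (∀ (j : Fin r) → d ∸ s ≤ toℕ j → Rcoeff d s r a x j ≈ 0#))
    × ((∀ (j : Fin r) → d ∸ s ≤ toℕ j → Rcoeff d s r a x j ≈ 0#) →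
    (Σ (Vec Carrier (d ∸ s)) λ g → ∀ i → eval (fa d s a ⊕ toList g) (x i) ≈ 0#))
lemma2p2 F d s r _ _ m+1≤r _ a x x-injective =
  Interpolation.interpolation-criterion F r (ℕ.≤-trans (ℕ.m≤m+n (d ∸ s) 1) m+1≤r) (Poly.fa F d s a) x x-injective
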